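{- Let $n\ge 3$ and $N=2^n$. Then \[ \limsup_{n\to\infty}\ \frac{J_{2^n}}{2^{\,3\cdot 2^{n-2}-\frac{n-3}{2}}}\ \le\ 0.3258, \] i.e. $J_N\le 0.3258\cdot 2^{3\cdot 2^{n-2}-\frac{n-3}{2}}$ asymptotically as $n\to\infty$.
   Context: For a positive integer $N$, $J_N$ denotes the number of sign vectors $(\delta_0,\ldots,\delta_N)\in\{ -1,1\}^{N+1}$ such that $\sum_{i=0}^{N}\delta_i\binom{N}{i}=0$. -}

module Defs where

open import Data.Nat using (ℕ; zero; suc; _+_; _*_; _∸_; _^_)
open import Data.Nat.Combinatorics using (_C_)
open import Data.Integer as ℤ using (ℤ; _◃_; +_)
open import Data.Sign using (Sign) renaming (+ to plus; - to minus)
open import Data.Fin using (Fin; toℕ) renaming (zero to fzero; suc to fsuc)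
open import Data.Vec using (Vec; []; _∷_; tabulate; lookup)
open import Data.List using (List; []; _∷_; concatMap; filter; length)
open import Data.Rational using (ℚ; _/_)
open import Relation.Binary.PropositionalEquality using (_≡_)

allSigns : (k : ℕ) → List (Vec Sign k)
allSigns zero = [] ∷ []
allSigns (suc k) = concatMap (λ v → (plus ∷ v) ∷ (minus ∷ v) ∷ []) (allSigns k)

sumFin : {m : ℕ} → (Fin m → ℤ) → ℤ
sumFin {zero} f = + 0
sumFin {suc m} f = f fzero ℤ.+ sumFin (λ i → f (fsuc i))

signedBinomSum : (N : ℕ) → Vec Sign (suc N) → ℤ
signedBinomSum N δ = sumFin (λ i → lookup δ i ◃ (N C toℕ i))

J : ℕ → ℕ
J N = length (filter (λ δ → signedBinomSum N δ ℤ.≟ + 0) (allSigns (suc N)))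

ℕ→ℚ : ℕ → ℚ
ℕ→ℚ k = + k / 1

c₀ : ℚ
c₀ = + 3258 / 10000

-- J N counts the solutions of  Σ δᵢ·C(N,i) = 0.  For 3k + 2 ≤ N we have C(N,k+1) ≥ 2·C(N,k), so
-- the binomials C(N,m), …, C(N,1), C(N,0) with 3m ≤ N form a superdecreasing sequence: each
-- exceeds the sum of those after it.  Once the first N − m signs are chosen, at most one choice
-- of signs for these last m + 1 entries balances the sum, whence J N ≤ 2^(N−m).  With N = 2ⁿ and
-- m = 5N/16 this gives J(2ⁿ) ≤ 2^(11N/16), far below 0.3258 · 2^(3N/4 − (n−3)/2) for n ≥ 6.
module Submission where

open import Defs
open import Data.Nat using (ℕ; zero; suc; _+_; _*_; _∸_; _^_; _≤_; _<_; z≤n; s≤s)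
import Data.Nat.Properties as ℕₚ
import Data.Nat.Tactic.RingSolver as ℕ-Solver
open import Data.Nat.Combinatorics using (_C_; nCk+nC[k+1]≡[n+1]C[k+1]; nCk≡nC[n∸k]; nC1≡n)
open import Data.Integer as ℤ using (ℤ; -[1+_]; _◃_; ∣_∣)
import Data.Integer.Properties as ℤₚ
import Data.Integer.Tactic.RingSolver as ℤ-Solver
open import Data.Rational as ℚ using (ℚ; Positive; _/_)
import Data.Rational.Properties as ℚₚ
import Data.Rational.Unnormalised as ℚᵘ
import Data.Rational.Unnormalised.Properties as ℚᵘₚ
open import Data.Sign using (Sign) renaming (+ to plus; - to minus)
open import Data.Fin as Fin using (Fin; toℕ; _↑ʳ_; cast)
import Data.Fin.Properties as Finₚ
open import Data.Vec as Vec using (Vec; _∷_; lookup)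
open import Data.Vec.Functional using (Vector; head; tail)
open import Data.List using ([]; _∷_; concatMap; filter; length)
open import Data.List.Properties using (filter-≐; filter-reject; length-filter)
open import Algebra.Properties.Monoid.Sum ℕₚ.+-0-monoid using (sum)
open import Data.Product using (_×_; _,_; ∃-syntax)
open import Data.Sum using (_⊎_; inj₁; inj₂)
open import Data.Unit using (⊤)
open import Data.Bool using (true; false)
open import Function using (_∘_)
open import Relation.Nullary using (does)
open import Relation.Nullary.Decidable using (toWitness)
open import Relation.Unary using (Pred; Decidable)
open import Relation.Binary.PropositionalEquality hiding (J)

module _ {a b p} {A : Set a} {B : Set b} {P : Pred B p} (P? : Decidable P) (f g : A → B) where

  length-filter-concatMap-pair : ∀ xs →
    length (filter P? (concatMap (λ x → f x ∷ g x ∷ []) xs)) ≡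
    length (filter (P? ∘ f) xs) + length (filter (P? ∘ g) xs)
  length-filter-concatMap-pair [] = refl
  length-filter-concatMap-pair (x ∷ xs) with does (P? (f x))
  ... | false with does (P? (g x))
  ...   | false = length-filter-concatMap-pair xs
  ...   | true  = trans (cong suc (length-filter-concatMap-pair xs)) (sym (ℕₚ.+-suc _ _))
  length-filter-concatMap-pair (x ∷ xs) | true with does (P? (g x))
  ...   | false = cong suc (length-filter-concatMap-pair xs)
  ...   | true  = cong suc (trans (cong suc (length-filter-concatMap-pair xs)) (sym (ℕₚ.+-suc _ _)))

i+j≡k⇒j≡k-i : ∀ {i j k : ℤ} → i ℤ.+ j ≡ k → j ≡ k ℤ.- i
i+j≡k⇒j≡k-i {i} {j} refl = sym (i+j-i≡j i j)
  where
  i+j-i≡j : ∀ i j → i ℤ.+ j ℤ.- i ≡ j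
  i+j-i≡j = solve-∀ where open ℤ-Solver

j≡k-i⇒i+j≡k : ∀ {i j k : ℤ} → j ≡ k ℤ.- i → i ℤ.+ j ≡ k
j≡k-i⇒i+j≡k {i} {k = k} refl = i+[k-i]≡k i k
  where
  i+[k-i]≡k : ∀ i k → i ℤ.+ (k ℤ.- i) ≡ k
  i+[k-i]≡k = solve-∀ where open ℤ-Solver

∣i∣≤∣i-j∣+∣j∣ : ∀ i j → ∣ i ∣ ≤ ∣ i ℤ.- j ∣ + ∣ j ∣
∣i∣≤∣i-j∣+∣j∣ i j =
  subst (λ x → ∣ x ∣ ≤ ∣ i ℤ.- j ∣ + ∣ j ∣) (i-j+j≡i i j) (ℤₚ.∣i+j∣≤∣i∣+∣j∣ (i ℤ.- j) j)
  where
  i-j+j≡i : ∀ i j → i ℤ.- j ℤ.+ j ≡ i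
  i-j+j≡i = solve-∀ where open ℤ-Solver

sumFin-cong : ∀ {k} {f g : Fin k → ℤ} → (∀ i → f i ≡ g i) → sumFin f ≡ sumFin g
sumFin-cong {zero}  f≗g = refl
sumFin-cong {suc k} f≗g = cong₂ ℤ._+_ (f≗g Fin.zero) (sumFin-cong (f≗g ∘ Fin.suc))

[1+k]*[1+n]C[1+k]≡[1+n]*nCk : ∀ n k → suc k * (suc n C suc k) ≡ suc n * (n C k)
[1+k]*[1+n]C[1+k]≡[1+n]*nCk zero    zero    = refl
[1+k]*[1+n]C[1+k]≡[1+n]*nCk zero    (suc k) = ℕₚ.*-zeroʳ (suc (suc k))
[1+k]*[1+n]C[1+k]≡[1+n]*nCk (suc n) zero    =
  trans (ℕₚ.*-identityˡ _) (trans (nC1≡n (suc (suc n))) (sym (ℕₚ.*-identityʳ (suc (suc n)))))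
[1+k]*[1+n]C[1+k]≡[1+n]*nCk (suc n) (suc k) = begin
  suc (suc k) * (suc (suc n) C suc (suc k))
    ≡⟨ cong (suc (suc k) *_) (nCk+nC[k+1]≡[n+1]C[k+1] (suc n) (suc k)) ⟨
  suc (suc k) * (x + y)
    ≡⟨ regroup k x y ⟩
  x + (suc k * x + suc (suc k) * y)
    ≡⟨ cong₂ (λ u v → x + (u + v)) ([1+k]*[1+n]C[1+k]≡[1+n]*nCk n k)
                                   ([1+k]*[1+n]C[1+k]≡[1+n]*nCk n (suc k)) ⟩
  x + (suc n * (n C k) + suc n * (n C suc k))
    ≡⟨ cong (x +_) (ℕₚ.*-distribˡ-+ (suc n) (n C k) (n C suc k)) ⟨
  x + suc n * (n C k + n C suc k)
    ≡⟨ cong (λ z → x + suc n * z) (nCk+nC[k+1]≡[n+1]C[k+1] n k) ⟩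
  suc (suc n) * x
    ∎
  where
  open ≡-Reasoning
  x = suc n C suc k
  y = suc n C suc (suc k)
  regroup : ∀ k x y → suc (suc k) * (x + y) ≡ x + (suc k * x + suc (suc k) * y)
  regroup = solve-∀ where open ℕ-Solver

3[1+m]≡1+[3m+2] : ∀ m → 3 * suc m ≡ suc (3 * m + 2)
3[1+m]≡1+[3m+2] = solve-∀ where open ℕ-Solver

3m+2≤3[1+m] : ∀ m → 3 * m + 2 ≤ 3 * suc m
3m+2≤3[1+m] m = ℕₚ.≤-trans (ℕₚ.n≤1+n _) (ℕₚ.≤-reflexive (sym (3[1+m]≡1+[3m+2] m)))

2*nCk≤nC[1+k] : ∀ {n k} → 3 * k + 2 ≤ n → 2 * (n C k) ≤ n C suc k
-- After multiplying by k + 1 this is (k+1)·C(n,k+1) = (n−k)·C(n,k) ≥ 2(k+1)·C(n,k).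
2*nCk≤nC[1+k] {n} {k} 3k+2≤n =
  ℕₚ.*-cancelˡ-≤ (suc k) (ℕₚ.+-cancelʳ-≤ (suc k * (n C k)) _ _ (begin
    suc k * (2 * (n C k)) + suc k * (n C k)   ≡⟨ triple k (n C k) ⟩
    3 * suc k * (n C k)                       ≤⟨ ℕₚ.*-monoˡ-≤ (n C k) 3[1+k]≤1+n ⟩
    suc n * (n C k)                           ≡⟨ [1+k]*[1+n]C[1+k]≡[1+n]*nCk n k ⟨
    suc k * (suc n C suc k)                   ≡⟨ cong (suc k *_) (nCk+nC[k+1]≡[n+1]C[k+1] n k) ⟨
    suc k * (n C k + n C suc k)               ≡⟨ ℕₚ.*-distribˡ-+ (suc k) (n C k) (n C suc k) ⟩
    suc k * (n C k) + suc k * (n C suc k)     ≡⟨ ℕₚ.+-comm (suc k * (n C k)) _ ⟩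
    suc k * (n C suc k) + suc k * (n C k)     ∎))
  where
  open ℕₚ.≤-Reasoning
  3[1+k]≤1+n : 3 * suc k ≤ suc n
  3[1+k]≤1+n = subst (_≤ suc n) (sym (3[1+m]≡1+[3m+2] k)) (s≤s 3k+2≤n)
  triple : ∀ k c → suc k * (2 * c) + suc k * c ≡ 3 * suc k * c
  triple = solve-∀ where open ℕ-Solver

signedSum : ∀ {k} → Vector ℕ k → Vec Sign k → ℤ
signedSum a δ = sumFin (λ i → lookup δ i ◃ a i)

solutions : ∀ {k} → Vector ℕ k → ℤ → ℕ
solutions {k} a t = length (filter (λ δ → signedSum a δ ℤ.≟ t) (allSigns k))

solutions-suc : ∀ {k} (a : Vector ℕ (suc k)) t → solutions a t ≡
  solutions (tail a) (t ℤ.- (plus ◃ head a)) + solutions (tail a) (t ℤ.- (minus ◃ head a))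
solutions-suc {k} a t =
  trans (length-filter-concatMap-pair _ (plus ∷_) (minus ∷_) (allSigns k))
        (cong₂ _+_ (branch plus) (branch minus))
  where
  branch : ∀ σ → length (filter (λ δ → signedSum a (σ ∷ δ) ℤ.≟ t) (allSigns k))
               ≡ solutions (tail a) (t ℤ.- (σ ◃ head a))
  branch σ = cong length (filter-≐ _ _ (i+j≡k⇒j≡k-i , j≡k-i⇒i+j≡k) (allSigns k))

solutions-cong : ∀ {k} {a b : Vector ℕ k} → (∀ i → a i ≡ b i) →
  ∀ t → solutions a t ≡ solutions b t
solutions-cong {k} {a} {b} a≗b t =
  cong length (filter-≐ _ _ ((λ {δ} → trans (sym (a≈b δ))) , (λ {δ} → trans (a≈b δ))) (allSigns k))
  where
  a≈b : ∀ δ → signedSum a δ ≡ signedSum b δ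
  a≈b δ = sumFin-cong (λ i → cong (lookup δ i ◃_) (a≗b i))

solutions-vanish : ∀ {k} (a : Vector ℕ k) {t} → sum a < ∣ t ∣ → solutions a t ≡ 0
solutions-vanish {zero} a {t} 0<∣t∣ =
  cong length (filter-reject (λ δ → signedSum a δ ℤ.≟ t)
                             (λ 0≡t → ℕₚ.<-irrefl (cong ∣_∣ 0≡t) 0<∣t∣))
solutions-vanish {suc k} a {t} a<∣t∣ =
  trans (solutions-suc a t) (cong₂ _+_ (branch plus) (branch minus))
  where
  branch : ∀ σ → solutions (tail a) (t ℤ.- (σ ◃ head a)) ≡ 0
  branch σ = solutions-vanish (tail a) (ℕₚ.+-cancelʳ-< x _ _ (begin-strict
    sum (tail a) + x                ≡⟨ ℕₚ.+-comm (sum (tail a)) x ⟩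
    sum a                           <⟨ a<∣t∣ ⟩
    ∣ t ∣                           ≤⟨ ∣i∣≤∣i-j∣+∣j∣ t (σ ◃ x) ⟩
    ∣ t ℤ.- (σ ◃ x) ∣ + ∣ σ ◃ x ∣   ≡⟨ cong (∣ t ℤ.- (σ ◃ x) ∣ +_) (ℤₚ.abs-◃ σ x) ⟩
    ∣ t ℤ.- (σ ◃ x) ∣ + x           ∎))
    where
    open ℕₚ.≤-Reasoning
    x = head a

Superdecreasing : ∀ {k} → Vector ℕ k → Set
Superdecreasing {zero}  a = ⊤
Superdecreasing {suc k} a = sum (tail a) < head a × Superdecreasing (tail a)

-- One of t − x and t + x has absolute value ∣t∣ + x ≥ x > sum a.
solutions-one-sign-vanishes : ∀ {k} (a : Vector ℕ k) {x} → sum a < x → ∀ t →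
  solutions a (t ℤ.- (plus ◃ x)) ≡ 0 ⊎ solutions a (t ℤ.- (minus ◃ x)) ≡ 0
solutions-one-sign-vanishes a {x} a<x (ℤ.+ m) = inj₂ (solutions-vanish a (ℕₚ.<-≤-trans a<x (begin
  x                                ≤⟨ ℕₚ.m≤n+m x m ⟩
  ∣ ℤ.+ m ℤ.+ ℤ.+ x ∣                ≡⟨ cong (λ i → ∣ ℤ.+ m ℤ.+ i ∣) (ℤₚ.neg-involutive (ℤ.+ x)) ⟨
  ∣ ℤ.+ m ℤ.- ℤ.- ℤ.+ x ∣            ≡⟨ cong (λ i → ∣ ℤ.+ m ℤ.- i ∣) (ℤₚ.-◃n≡-n x) ⟨
  ∣ ℤ.+ m ℤ.- (minus ◃ x) ∣          ∎)))
  where open ℕₚ.≤-Reasoning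
solutions-one-sign-vanishes a {x} a<x -[1+ m ] = inj₁ (solutions-vanish a (ℕₚ.<-≤-trans a<x (begin
  x                                ≤⟨ ℕₚ.m≤m+n x m ⟩
  x + m                            <⟨ ℕₚ.n<1+n (x + m) ⟩
  ∣ -[1+ x + m ] ∣                   ≡⟨ cong ∣_∣ (ℤₚ.neg-minus-pos m x) ⟨
  ∣ -[1+ m ] ℤ.- ℤ.+ x ∣             ≡⟨ cong (λ i → ∣ -[1+ m ] ℤ.- i ∣) (ℤₚ.+◃n≡+n x) ⟨
  ∣ -[1+ m ] ℤ.- (plus ◃ x) ∣        ∎)))
  where open ℕₚ.≤-Reasoning

solutions-superdecreasing-≤1 : ∀ {k} (a : Vector ℕ k) → Superdecreasing a →
  ∀ t → solutions a t ≤ 1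
solutions-superdecreasing-≤1 {zero} a _ t =
  length-filter (λ δ → signedSum a δ ℤ.≟ t) (Vec.[] ∷ [])
solutions-superdecreasing-≤1 {suc k} a (tail<head , sd) t =
  subst (_≤ 1) (sym (solutions-suc a t))
    (+-≤1 (solutions-one-sign-vanishes (tail a) tail<head t)
          (solutions-superdecreasing-≤1 (tail a) sd _)
          (solutions-superdecreasing-≤1 (tail a) sd _))
  where
  +-≤1 : ∀ {m n} → m ≡ 0 ⊎ n ≡ 0 → m ≤ 1 → n ≤ 1 → m + n ≤ 1
  +-≤1 (inj₁ refl) _ n≤1 = n≤1
  +-≤1 {m} (inj₂ refl) m≤1 _ = subst (_≤ 1) (sym (ℕₚ.+-identityʳ m)) m≤1

solutions≤2^r*c : ∀ r {s} (a : Vector ℕ (r + s)) {c} →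
  (∀ t → solutions (a ∘ (r ↑ʳ_)) t ≤ c) → ∀ t → solutions a t ≤ 2 ^ r * c
solutions≤2^r*c zero    a {c} tail≤c t =
  subst (solutions a t ≤_) (sym (ℕₚ.*-identityˡ c)) (tail≤c t)
solutions≤2^r*c (suc r) a {c} tail≤c t = begin
  solutions a t                        ≡⟨ solutions-suc a t ⟩
  solutions (tail a) _ + solutions (tail a) _
                                       ≤⟨ ℕₚ.+-mono-≤ (solutions≤2^r*c r (tail a) tail≤c _)
                                                       (solutions≤2^r*c r (tail a) tail≤c _) ⟩
  2 ^ r * c + 2 ^ r * c                ≡⟨ cong (2 ^ r * c +_) (ℕₚ.+-identityʳ (2 ^ r * c)) ⟨
  2 * (2 ^ r * c)                      ≡⟨ ℕₚ.*-assoc 2 (2 ^ r) c ⟨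
  2 ^ suc r * c                        ∎
  where open ℕₚ.≤-Reasoning

solutions-resize : ∀ {k k′} (k≡k′ : k ≡ k′) (a : Vector ℕ k) t →
  solutions a t ≡ solutions (a ∘ cast (sym k≡k′)) t
solutions-resize refl a = solutions-cong (λ i → cong a (sym (Finₚ.cast-is-id refl i)))

binomialTail : ℕ → (m : ℕ) → Vector ℕ (suc m)
binomialTail N m i = N C (m ∸ toℕ i)

sum-binomialTail<nC[1+m] : ∀ {N} m → 3 * m + 2 ≤ N → sum (binomialTail N m) < N C suc m
sum-binomialTail<nC[1+m] {N} zero    2≤N = subst (1 <_) (sym (nC1≡n N)) 2≤N
sum-binomialTail<nC[1+m] {N} (suc m) h = begin-strict
  N C suc m + sum (binomialTail N m) <⟨ ℕₚ.+-monoʳ-< (N C suc m) (sum-binomialTail<nC[1+m] m 3m+2≤N) ⟩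
  N C suc m + N C suc m             ≡⟨ cong (N C suc m +_) (ℕₚ.+-identityʳ (N C suc m)) ⟨
  2 * (N C suc m)                   ≤⟨ 2*nCk≤nC[1+k] h ⟩
  N C suc (suc m)                   ∎
  where
  open ℕₚ.≤-Reasoning
  3m+2≤N : 3 * m + 2 ≤ N
  3m+2≤N = ℕₚ.≤-trans (3m+2≤3[1+m] m) (ℕₚ.≤-trans (ℕₚ.m≤m+n _ 2) h)

binomialTail-superdecreasing : ∀ {N} m → 3 * m ≤ N → Superdecreasing (binomialTail N m)
binomialTail-superdecreasing zero    _    = s≤s z≤n , _
binomialTail-superdecreasing (suc m) 3m≤N =
  sum-binomialTail<nC[1+m] m (ℕₚ.≤-trans (3m+2≤3[1+m] m) 3m≤N) ,
  binomialTail-superdecreasing m (ℕₚ.≤-trans (ℕₚ.*-monoʳ-≤ 3 (ℕₚ.n≤1+n m)) 3m≤N)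

binomialRow : (N : ℕ) → Vector ℕ (suc N)
binomialRow N i = N C toℕ i

binomialRow-↑ʳ : ∀ {r m N} → r + m ≡ N → .(e : r + suc m ≡ suc N) →
  ∀ i → binomialRow N (cast e (r ↑ʳ i)) ≡ binomialTail N m i
binomialRow-↑ʳ {r} {m} refl e i = begin
  (r + m) C toℕ (cast e (r ↑ʳ i))
    ≡⟨ cong ((r + m) C_) (trans (Finₚ.toℕ-cast e (r ↑ʳ i)) (Finₚ.toℕ-↑ʳ r i)) ⟩
  (r + m) C (r + toℕ i)
    ≡⟨ nCk≡nC[n∸k] (ℕₚ.+-monoʳ-≤ r (Finₚ.toℕ≤pred[n] i)) ⟩
  (r + m) C ((r + m) ∸ (r + toℕ i))
    ≡⟨ cong ((r + m) C_) (ℕₚ.[m+n]∸[m+o]≡n∸o r m (toℕ i)) ⟩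
  (r + m) C (m ∸ toℕ i)
    ∎
  where open ≡-Reasoning

J≤2^[N∸m] : ∀ {N} m → 3 * m ≤ N → J N ≤ 2 ^ (N ∸ m)
J≤2^[N∸m] {N} m 3m≤N = begin
  J N                                ≡⟨⟩
  solutions (binomialRow N) (ℤ.+ 0)  ≡⟨ solutions-resize 1+N≡r+[1+m] (binomialRow N) (ℤ.+ 0) ⟩
  solutions row′ (ℤ.+ 0)             ≤⟨ solutions≤2^r*c r row′ tail≤1 (ℤ.+ 0) ⟩
  2 ^ r * 1                          ≡⟨ ℕₚ.*-identityʳ (2 ^ r) ⟩
  2 ^ r                              ∎
  where
  open ℕₚ.≤-Reasoning
  r = N ∸ m
  r+m≡N : r + m ≡ N
  r+m≡N = ℕₚ.m∸n+n≡m (ℕₚ.≤-trans (ℕₚ.m≤n*m m 3) 3m≤N)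
  1+N≡r+[1+m] : suc N ≡ r + suc m
  1+N≡r+[1+m] = trans (cong suc (sym r+m≡N)) (sym (ℕₚ.+-suc r m))
  row′ : Vector ℕ (r + suc m)
  row′ = binomialRow N ∘ cast (sym 1+N≡r+[1+m])
  tail≤1 : ∀ t → solutions (row′ ∘ (r ↑ʳ_)) t ≤ 1
  tail≤1 t = subst (_≤ 1) (sym (solutions-cong (binomialRow-↑ʳ {r} {m} r+m≡N _) t))
    (solutions-superdecreasing-≤1 (binomialTail N m) (binomialTail-superdecreasing m 3m≤N) t)

7+t≤2^[3+t] : ∀ t → 7 + t ≤ 2 ^ (3 + t)
7+t≤2^[3+t] zero    = ℕₚ.n≤1+n 7
7+t≤2^[3+t] (suc t) = begin
  1 + (7 + t)                ≤⟨ ℕₚ.+-mono-≤ (ℕₚ.m^n>0 2 (3 + t)) (7+t≤2^[3+t] t) ⟩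
  2 ^ (3 + t) + 2 ^ (3 + t)  ≡⟨ cong (2 ^ (3 + t) +_) (ℕₚ.+-identityʳ (2 ^ (3 + t))) ⟨
  2 ^ (4 + t)                ∎
  where open ℕₚ.≤-Reasoning

16*J[2^[6+t]]²*2^[3+t]≤2^[3*2^[5+t]] : ∀ t →
  16 * (J (2 ^ (6 + t)) * J (2 ^ (6 + t)) * 2 ^ (3 + t)) ≤ 2 ^ (3 * 2 ^ (5 + t))
16*J[2^[6+t]]²*2^[3+t]≤2^[3*2^[5+t]] t = begin
  16 * (J N * J N * 2 ^ (3 + t))
    ≤⟨ ℕₚ.*-monoʳ-≤ 16 (ℕₚ.*-monoˡ-≤ (2 ^ (3 + t)) (ℕₚ.*-mono-≤ J≤2^E J≤2^E)) ⟩
  16 * (2 ^ E * 2 ^ E * 2 ^ (3 + t))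
    ≡⟨ cong (λ z → 16 * (z * 2 ^ (3 + t))) (ℕₚ.^-distribˡ-+-* 2 E E) ⟨
  16 * (2 ^ (E + E) * 2 ^ (3 + t))
    ≡⟨ cong (16 *_) (ℕₚ.^-distribˡ-+-* 2 (E + E) (3 + t)) ⟨
  2 ^ 4 * 2 ^ (E + E + (3 + t))
    ≡⟨ ℕₚ.^-distribˡ-+-* 2 4 (E + E + (3 + t)) ⟨
  2 ^ (4 + (E + E + (3 + t)))
    ≤⟨ ℕₚ.^-monoʳ-≤ 2 exponent-bound ⟩
  2 ^ (3 * 2 ^ (5 + t))
    ∎
  where
  open ℕₚ.≤-Reasoning
  open ℕ-Solver
  N L E : ℕ
  N = 2 ^ (6 + t)
  L = 2 ^ (2 + t)
  E = 11 * L
  -- N unfolds definitionally to 2 * (2 * (2 * (2 * L))), and 2 ^ (5 + t) to 2 * (2 * (2 * L)).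
  16L≡11L+5L : ∀ L → 2 * (2 * (2 * (2 * L))) ≡ 11 * L + 5 * L
  16L≡11L+5L = solve-∀
  16L≡3[5L]+L : ∀ L → 2 * (2 * (2 * (2 * L))) ≡ 3 * (5 * L) + L
  16L≡3[5L]+L = solve-∀
  N≡E+5L : N ≡ E + 5 * L
  N≡E+5L = 16L≡11L+5L L
  3*5L≤N : 3 * (5 * L) ≤ N
  3*5L≤N = subst (3 * (5 * L) ≤_) (sym (16L≡3[5L]+L L)) (ℕₚ.m≤m+n (3 * (5 * L)) L)
  J≤2^E : J N ≤ 2 ^ E
  J≤2^E = subst (λ k → J N ≤ 2 ^ k)
                (trans (cong (_∸ 5 * L) N≡E+5L) (ℕₚ.m+n∸n≡m E (5 * L)))
                (J≤2^[N∸m] (5 * L) 3*5L≤N)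
  exponent-bound : 4 + (E + E + (3 + t)) ≤ 3 * 2 ^ (5 + t)
  exponent-bound = begin
    4 + (E + E + (3 + t))  ≡⟨ collect L t ⟩
    22 * L + (7 + t)       ≤⟨ ℕₚ.+-monoʳ-≤ (22 * L) (7+t≤2^[3+t] t) ⟩
    22 * L + 2 * L         ≡⟨ 22L+2L≡3[8L] L ⟩
    3 * 2 ^ (5 + t)        ∎
    where
    collect : ∀ L t → 4 + (11 * L + 11 * L + (3 + t)) ≡ 22 * L + (7 + t)
    collect = solve-∀
    22L+2L≡3[8L] : ∀ L → 22 * L + 2 * L ≡ 3 * (2 * (2 * (2 * L)))
    22L+2L≡3[8L] = solve-∀

ℕ→ℚᵘ : ℕ → ℚᵘ.ℚᵘ
ℕ→ℚᵘ n = ℚᵘ.mkℚᵘ (ℤ.+ n) 0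

toℚᵘ-ℕ→ℚ : ∀ n → ℚ.toℚᵘ (ℕ→ℚ n) ℚᵘ.≃ ℕ→ℚᵘ n
toℚᵘ-ℕ→ℚ n = ℚₚ.toℚᵘ-fromℚᵘ (ℕ→ℚᵘ n)

ℕ→ℚ-homo-* : ∀ m n → ℕ→ℚ (m * n) ≡ ℕ→ℚ m ℚ.* ℕ→ℚ n
ℕ→ℚ-homo-* m n = ℚₚ.toℚᵘ-injective (begin
  ℚ.toℚᵘ (ℕ→ℚ (m * n))                    ≈⟨ toℚᵘ-ℕ→ℚ (m * n) ⟩
  ℕ→ℚᵘ (m * n)                           ≡⟨ cong (λ i → ℚᵘ.mkℚᵘ i 0) (ℤₚ.pos-* m n) ⟩
  ℕ→ℚᵘ m ℚᵘ.* ℕ→ℚᵘ n                      ≈⟨ ℚᵘₚ.*-cong (toℚᵘ-ℕ→ℚ m) (toℚᵘ-ℕ→ℚ n) ⟨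
  ℚ.toℚᵘ (ℕ→ℚ m) ℚᵘ.* ℚ.toℚᵘ (ℕ→ℚ n)      ≈⟨ ℚₚ.toℚᵘ-homo-* (ℕ→ℚ m) (ℕ→ℚ n) ⟨
  ℚ.toℚᵘ (ℕ→ℚ m ℚ.* ℕ→ℚ n)                ∎)
  where open ℚᵘₚ.≃-Reasoning

ℕ→ℚ-mono-≤ : ∀ {m n} → m ≤ n → ℕ→ℚ m ℚ.≤ ℕ→ℚ n
ℕ→ℚ-mono-≤ {m} {n} m≤n = ℚₚ.toℚᵘ-cancel-≤
  (ℚᵘₚ.≤-respˡ-≃ (ℚᵘₚ.≃-sym (toℚᵘ-ℕ→ℚ m)) (ℚᵘₚ.≤-respʳ-≃ (ℚᵘₚ.≃-sym (toℚᵘ-ℕ→ℚ n)) m≤ᵘn))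
  where
  m≤ᵘn : ℕ→ℚᵘ m ℚᵘ.≤ ℕ→ℚᵘ n
  m≤ᵘn = ℚᵘ.*≤* (subst₂ ℤ._≤_ (sym (ℤₚ.*-identityʳ (ℤ.+ m))) (sym (ℤₚ.*-identityʳ (ℤ.+ n)))
                               (ℤ.+≤+ m≤n))

sixteenth : ℚ
sixteenth = ℤ.+ 1 / 16

16*m≤n⇒ℕ→ℚm≤sixteenth*ℕ→ℚn : ∀ {m n} → 16 * m ≤ n →
  ℕ→ℚ m ℚ.≤ sixteenth ℚ.* ℕ→ℚ n
16*m≤n⇒ℕ→ℚm≤sixteenth*ℕ→ℚn {m} {n} 16m≤n = begin
  ℕ→ℚ m                                   ≡⟨ ℚₚ.*-identityˡ (ℕ→ℚ m) ⟨
  (sixteenth ℚ.* ℕ→ℚ 16) ℚ.* ℕ→ℚ m         ≡⟨ ℚₚ.*-assoc sixteenth (ℕ→ℚ 16) (ℕ→ℚ m) ⟩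
  sixteenth ℚ.* (ℕ→ℚ 16 ℚ.* ℕ→ℚ m)         ≡⟨ cong (sixteenth ℚ.*_) (ℕ→ℚ-homo-* 16 m) ⟨
  sixteenth ℚ.* ℕ→ℚ (16 * m)               ≤⟨ ℚₚ.*-monoˡ-≤-nonNeg sixteenth (ℕ→ℚ-mono-≤ 16m≤n) ⟩
  sixteenth ℚ.* ℕ→ℚ n                      ∎
  where
  open ℚₚ.≤-Reasoning
  instance _ = ℚₚ.normalize-nonNeg 1 16

sixteenth≤[c₀+ε]² : ∀ ε → Positive ε → sixteenth ℚ.≤ (c₀ ℚ.+ ε) ℚ.* (c₀ ℚ.+ ε)
sixteenth≤[c₀+ε]² ε pos = begin
  sixteenth                     ≤⟨ toWitness {a? = sixteenth ℚ.≤? c₀ ℚ.* c₀} _ ⟩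
  c₀ ℚ.* c₀                     ≤⟨ ℚₚ.*-monoˡ-≤-nonNeg c₀ c₀≤c₀+ε ⟩
  c₀ ℚ.* (c₀ ℚ.+ ε)             ≤⟨ ℚₚ.*-monoʳ-≤-nonNeg (c₀ ℚ.+ ε) {{0≤c₀+ε}} c₀≤c₀+ε ⟩
  (c₀ ℚ.+ ε) ℚ.* (c₀ ℚ.+ ε)     ∎
  where
  open ℚₚ.≤-Reasoning
  instance
    _ = ℚₚ.normalize-nonNeg 3258 10000
    _ = ℚₚ.pos⇒nonNeg ε {{pos}}
  0≤c₀+ε = ℚₚ.nonNeg+nonNeg⇒nonNeg c₀ ε
  c₀≤c₀+ε : c₀ ℚ.≤ c₀ ℚ.+ ε
  c₀≤c₀+ε = subst (ℚ._≤ c₀ ℚ.+ ε) (ℚₚ.+-identityʳ c₀) (ℚₚ.+-monoʳ-≤ c₀ (ℚₚ.nonNegative⁻¹ ε))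

J[2^[6+t]]²-bound : ∀ ε → Positive ε → ∀ t → let N = 2 ^ (6 + t) in
  (ℕ→ℚ (J N) ℚ.* ℕ→ℚ (J N)) ℚ.* ℕ→ℚ (2 ^ (3 + t))
    ℚ.≤ ((c₀ ℚ.+ ε) ℚ.* (c₀ ℚ.+ ε)) ℚ.* ℕ→ℚ (2 ^ (3 * 2 ^ (5 + t)))
J[2^[6+t]]²-bound ε ε>0 t = begin
  (ℕ→ℚ (J N) ℚ.* ℕ→ℚ (J N)) ℚ.* ℕ→ℚ (2 ^ (3 + t))
    ≡⟨ cong (ℚ._* ℕ→ℚ (2 ^ (3 + t))) (ℕ→ℚ-homo-* (J N) (J N)) ⟨
  ℕ→ℚ (J N * J N) ℚ.* ℕ→ℚ (2 ^ (3 + t))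
    ≡⟨ ℕ→ℚ-homo-* (J N * J N) (2 ^ (3 + t)) ⟨
  ℕ→ℚ (J N * J N * 2 ^ (3 + t))
    ≤⟨ 16*m≤n⇒ℕ→ℚm≤sixteenth*ℕ→ℚn {J N * J N * 2 ^ (3 + t)}
                                (16*J[2^[6+t]]²*2^[3+t]≤2^[3*2^[5+t]] t) ⟩
  sixteenth ℚ.* ℕ→ℚ (2 ^ (3 * 2 ^ (5 + t)))
    ≤⟨ ℚₚ.*-monoʳ-≤-nonNeg (ℕ→ℚ Y) {{ℚₚ.normalize-nonNeg Y 1}} (sixteenth≤[c₀+ε]² ε ε>0) ⟩
  ((c₀ ℚ.+ ε) ℚ.* (c₀ ℚ.+ ε)) ℚ.* ℕ→ℚ (2 ^ (3 * 2 ^ (5 + t)))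
    ∎
  where
  open ℚₚ.≤-Reasoning
  N = 2 ^ (6 + t)
  Y = 2 ^ (3 * 2 ^ (5 + t))

theorem5 : (ε : ℚ) → Positive ε →
    ∃[ M ] ((n : ℕ) → M ≤ n → 3 ≤ n →
    (ℕ→ℚ (J (2 ^ n)) ℚ.* ℕ→ℚ (J (2 ^ n))) ℚ.* ℕ→ℚ (2 ^ (n ∸ 3))
    ℚ.≤ ((c₀ ℚ.+ ε) ℚ.* (c₀ ℚ.+ ε)) ℚ.* ℕ→ℚ (2 ^ (3 * 2 ^ (n ∸ 1))))
theorem5 ε ε>0 = 6 , λ where
  (suc (suc (suc (suc (suc (suc t)))))) (s≤s (s≤s (s≤s (s≤s (s≤s (s≤s _)))))) _ →
    J[2^[6+t]]²-bound ε ε>0 t
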